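{- Let $n\ge 1$ and let $Q_n$ be the $n$-cube with vertex set $V_n=\{(\epsilon_1,\dots,\epsilon_n): \epsilon_i\in\{ -1,1\}\}$. A $2$-coloring of $Q_n$ assigns to each vertex either black (weight $1$) or white (weight $0$); it is balanced if the sum of the black vertices, viewed as vectors in $\mathbb{R}^n$, is the zero vector (a coloring with no black vertices is also balanced). Two vertices $v,-v$ form an antipodal pair. For $k\ge 0$ and $i\ge 0$, let $\mathcal{B}_{n,2k,i}$ be the set of balanced $2$-colorings of $Q_n$ with exactly $2k$ black vertices containing exactly $i$ antipodal pairs of black vertices (i.e. exactly $i$ pairs $\{v,-v\}$ with both $v$ and $-v$ black). Then \[ (2^{n-1}-2k+i)\,|\mathcal{B}_{n,2k,i}|=(i+1)\,|\mathcal{B}_{n,2k+2,i+1}| \] for all $0\le i\le k$ and $1\le k\le 2^{n-2}-1$.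
   Context: Balanced means the center of mass $\frac{1}{w}\sum v$ (sum over black vertices $v$, $w$ the number of black vertices) equals the origin, with the convention that the empty coloring has center of mass at the origin. -}

module Defs where

open import Data.Bool using (Bool; true; false; not; if_then_else_)
open import Data.Nat using (ℕ; zero; suc)
open import Data.Fin using (Fin)
open import Data.Vec using (Vec; []; _∷_; lookup; map)
open import Data.List using (List; []; _∷_; _++_; concatMap; length; filter)
import Data.List as L
open import Data.List.Relation.Unary.All using (All; all?)
open import Data.Integer using (ℤ; +_; -[1+_]; _≟_)
import Data.Integer as ℤ
open import Data.Product using (_×_; _,_)
open import Relation.Binary.PropositionalEquality using (_≡_)
open import Relation.Nullary using (Dec; _×-dec_)
import Data.Nat as ℕ
import Data.Fin as F

-- A vertex of Q_n: entry true ↦ +1, false ↦ -1.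
Vertex : ℕ → Set
Vertex n = Vec Bool n

sign : Bool → ℤ
sign true  = + 1
sign false = -[1+ 0 ]

neg : ∀ {n} → Vertex n → Vertex n
neg = map not

allVertices : (n : ℕ) → List (Vertex n)
allVertices zero    = [] ∷ []
allVertices (suc n) = L.map (true ∷_) (allVertices n) ++ L.map (false ∷_) (allVertices n)

-- a 2-coloring: true = black (weight 1), false = white (weight 0)
Coloring : ℕ → Set
Coloring n = Vertex n → Bool

-- list of all 2^(2^n) colorings, each (extensionally) exactly once
allColorings : (n : ℕ) → List (Coloring n)
allColorings zero = (λ _ → false) ∷ (λ _ → true) ∷ []
allColorings (suc n) =
  concatMap (λ ct → L.map (λ cf → glue ct cf) (allColorings n)) (allColorings n)
  where
  glue : Coloring n → Coloring n → Coloring (suc n)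
  glue ct cf (b ∷ v) = if b then ct v else cf v

countV : ∀ {n} → (Vertex n → Bool) → ℕ
countV {n} p = length (filter (λ v → Data.Bool._≟_ (p v) true) (allVertices n))

blackCount : ∀ {n} → Coloring n → ℕ
blackCount c = countV c

-- number of black vertices v whose antipode -v is also black
-- (= twice the number of antipodal pairs {v,-v} of black vertices)
antipodalBlackVertices : ∀ {n} → Coloring n → ℕ
antipodalBlackVertices c = countV (λ v → c v Data.Bool.∧ c (neg v))

-- j-th coordinate of the sum of the black vertices (as vectors in ℤ^n ⊆ ℝ^n)
blackSumCoord : ∀ {n} → Coloring n → Fin n → ℤ
blackSumCoord {n} c j =
  L.foldr ℤ._+_ (+ 0) (L.map (λ v → if c v then sign (lookup v j) else + 0) (allVertices n))

Balanced : ∀ {n} → Coloring n → Set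
Balanced {n} c = All (λ j → blackSumCoord c j ≡ + 0) (L.allFin n)

balanced? : ∀ {n} (c : Coloring n) → Dec (Balanced c)
balanced? {n} c = all? (λ j → blackSumCoord c j ≟ + 0) (L.allFin n)

InB : ∀ {n} → ℕ → ℕ → Coloring n → Set
InB m i c = Balanced c × blackCount c ≡ m × antipodalBlackVertices c ≡ 2 ℕ.* i

inB? : ∀ {n} m i (c : Coloring n) → Dec (InB m i c)
inB? m i c = balanced? c ×-dec (blackCount c ℕ.≟ m ×-dec antipodalBlackVertices c ℕ.≟ 2 ℕ.* i)

cardB : ℕ → ℕ → ℕ → ℕ
cardB n m i = length (filter (inB? m i) (allColorings n))

-- Double counting the pairs (c, u) with c ∈ B_{n,2k,i} and u, -u both white in c. By
-- inclusion–exclusion each such c has 2(2^{n-1} - 2k + i) such u. Colouring u and -u black adds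
-- u + (-u) = 0 to the vector sum, two black vertices and one black antipodal pair, so it maps these
-- pairs bijectively onto the pairs (c', u) with c' ∈ B_{n,2k+2,i+1} and u, -u both black in c';
-- each such c' has 2(i+1) such u.
module Submission where

open import Defs
open import Data.Nat using (ℕ; _+_; _*_; _∸_; _^_; _≤_)
open import Relation.Binary.PropositionalEquality using (_≡_)

open import Algebra.Bundles using (CommutativeSemigroup)
open import Algebra.Structures using (IsCommutativeMonoid)
open import Data.Bool using (Bool; true; false; not; _∧_; _xor_; if_then_else_)
import Data.Bool as Bool
import Data.Bool.Properties as BoolP
open import Data.Empty using (⊥-elim)
import Data.Integer as ℤ
import Data.Integer.Properties as ℤP
open import Data.List using (List; []; _∷_; _++_; concatMap; length; filter)
import Data.List as List
import Data.List.Relation.Unary.All as All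
open import Data.Nat using (zero; suc; s≤s)
import Data.Nat.Properties as ℕP
open import Data.Nat.Solver using (module +-*-Solver)
open import Data.Product using (_×_; _,_)
open import Data.Sum using (_⊎_; inj₁; inj₂)
open import Data.Vec using ([]; _∷_; lookup)
import Data.Vec.Properties as VecP
open import Level using (0ℓ)
open import Function using (_∘_; _⇔_; mk⇔)
open import Relation.Binary.PropositionalEquality
  using (refl; sym; trans; cong; cong₂; _≗_; module ≡-Reasoning)
open import Relation.Nullary using (Dec; yes; no; does; ¬_)
open import Relation.Nullary.Decidable using (does-⇔)
open import Relation.Unary using (Decidable)

_≟ᵥ_ : ∀ {n} (u v : Vertex n) → Dec (u ≡ v)
_≟ᵥ_ = VecP.≡-dec Bool._≟_

infix 4 _≟ᵥ_

neg-involutive : ∀ {n} (v : Vertex n) → neg (neg v) ≡ v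
neg-involutive []      = refl
neg-involutive (b ∷ v) = cong₂ _∷_ (BoolP.not-involutive b) (neg-involutive v)

neg-injective : ∀ {n} {u v : Vertex n} → neg u ≡ neg v → u ≡ v
neg-injective {u = u} {v} eq =
  trans (sym (neg-involutive u)) (trans (cong neg eq) (neg-involutive v))

neg-≡⇔≡-neg : ∀ {n} {u v : Vertex n} → neg u ≡ v ⇔ u ≡ neg v
neg-≡⇔≡-neg {u = u} =
  mk⇔ (λ eq → trans (sym (neg-involutive u)) (cong neg eq))
      (λ eq → trans (cong neg eq) (neg-involutive _))

neg-≢ : ∀ {n} (v : Vertex (suc n)) → ¬ v ≡ neg v
neg-≢ (true  ∷ _) ()
neg-≢ (false ∷ _) ()

-- The indicator of {v, -v}; the two events are exclusive because v ≠ -v.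
antipodalPair : ∀ {n} → Vertex n → Coloring n
antipodalPair v u = does (u ≟ᵥ v) xor does (u ≟ᵥ neg v)

module _ {n} (v : Vertex (suc n)) where

  antipodalPair-self : antipodalPair v v ≡ true
  antipodalPair-self with v ≟ᵥ v | v ≟ᵥ neg v
  ... | yes _ | no _    = refl
  ... | _     | yes eq  = ⊥-elim (neg-≢ v eq)
  ... | no v≢v | _      = ⊥-elim (v≢v refl)

  antipodalPair-neg-self : antipodalPair v (neg v) ≡ true
  antipodalPair-neg-self with neg v ≟ᵥ v | neg v ≟ᵥ neg v
  ... | no _  | yes _      = refl
  ... | yes eq | _         = ⊥-elim (neg-≢ v (sym eq))
  ... | _     | no -v≢-v   = ⊥-elim (-v≢-v refl)

  antipodalPair-neg : ∀ u → antipodalPair v (neg u) ≡ antipodalPair v u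
  antipodalPair-neg u = begin
    does (neg u ≟ᵥ v) xor does (neg u ≟ᵥ neg v)
      ≡⟨ cong₂ _xor_ (does-⇔ neg-≡⇔≡-neg (neg u ≟ᵥ v) (u ≟ᵥ neg v))
                     (does-⇔ (mk⇔ neg-injective (cong neg)) (neg u ≟ᵥ neg v) (u ≟ᵥ v)) ⟩
    does (u ≟ᵥ neg v) xor does (u ≟ᵥ v)
      ≡⟨ BoolP.xor-comm (does (u ≟ᵥ neg v)) _ ⟩
    does (u ≟ᵥ v) xor does (u ≟ᵥ neg v) ∎
    where open ≡-Reasoning

  antipodalPair-true : ∀ u → antipodalPair v u ≡ true → u ≡ v ⊎ u ≡ neg v
  antipodalPair-true u _  with u ≟ᵥ v | u ≟ᵥ neg v
  antipodalPair-true u _  | yes eq | _      = inj₁ eq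
  antipodalPair-true u _  | no _   | yes eq = inj₂ eq
  antipodalPair-true u () | no _   | no _

_⊕_ : ∀ {n} → Coloring n → Coloring n → Coloring n
(c ⊕ t) u = c u xor t u

infixl 6 _⊕_

-- Colorings are functions, so the enumeration allColorings only meets every coloring up to ≗.
Extensional : ∀ {n} {A : Set} → (Coloring n → A) → Set
Extensional g = ∀ {c d} → c ≗ d → g c ≡ g d

_∣_ : ∀ {n} → Coloring n → Coloring n → Coloring (suc n)
(ct ∣ cf) (b ∷ v) = if b then ct v else cf v

module ListSum {A : Set} {_∙_ : A → A → A} {ε : A}
               (isCommutativeMonoid : IsCommutativeMonoid _≡_ _∙_ ε) where

  open IsCommutativeMonoid isCommutativeMonoid
    using (assoc; comm; identityˡ; identityʳ; isCommutativeSemigroup)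
  private
    commutativeSemigroup : CommutativeSemigroup 0ℓ 0ℓ
    commutativeSemigroup = record { isCommutativeSemigroup = isCommutativeSemigroup }
  open import Algebra.Properties.CommutativeSemigroup commutativeSemigroup using (interchange)
  open ≡-Reasoning

  sum : {X : Set} → (X → A) → List X → A
  sum f xs = List.foldr _∙_ ε (List.map f xs)

  when : Bool → A → A
  when b x = if b then x else ε

  sum-cong : {X : Set} {f g : X → A} → f ≗ g → ∀ xs → sum f xs ≡ sum g xs
  sum-cong f≗g []       = refl
  sum-cong f≗g (x ∷ xs) = cong₂ _∙_ (f≗g x) (sum-cong f≗g xs)

  sum-ε : {X : Set} (xs : List X) → sum (λ _ → ε) xs ≡ ε
  sum-ε []       = refl
  sum-ε (x ∷ xs) = trans (cong (ε ∙_) (sum-ε xs)) (identityˡ ε)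

  sum-++ : {X : Set} (f : X → A) (xs ys : List X) → sum f (xs ++ ys) ≡ sum f xs ∙ sum f ys
  sum-++ f []       ys = sym (identityˡ _)
  sum-++ f (x ∷ xs) ys = trans (cong (f x ∙_) (sum-++ f xs ys)) (sym (assoc _ _ _))

  sum-map : {X Y : Set} (f : Y → A) (g : X → Y) (xs : List X) →
            sum f (List.map g xs) ≡ sum (f ∘ g) xs
  sum-map f g []       = refl
  sum-map f g (x ∷ xs) = cong (f (g x) ∙_) (sum-map f g xs)

  sum-concatMap : {X Y : Set} (f : Y → A) (h : X → List Y) (xs : List X) →
                  sum f (concatMap h xs) ≡ sum (λ x → sum f (h x)) xs
  sum-concatMap f h []       = refl
  sum-concatMap f h (x ∷ xs) =
    trans (sum-++ f (h x) (concatMap h xs)) (cong (sum f (h x) ∙_) (sum-concatMap f h xs))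

  sum-∙ : {X : Set} (f g : X → A) (xs : List X) →
          sum (λ x → f x ∙ g x) xs ≡ sum f xs ∙ sum g xs
  sum-∙ f g []       = sym (identityˡ ε)
  sum-∙ f g (x ∷ xs) = trans (cong ((f x ∙ g x) ∙_) (sum-∙ f g xs)) (interchange _ _ _ _)

  sum-swap : {X Y : Set} (f : X → Y → A) (xs : List X) (ys : List Y) →
             sum (λ x → sum (f x) ys) xs ≡ sum (λ y → sum (λ x → f x y) xs) ys
  sum-swap f []       ys = sym (sum-ε ys)
  sum-swap f (x ∷ xs) ys =
    trans (cong (sum (f x) ys ∙_) (sum-swap f xs ys)) (sym (sum-∙ (f x) _ ys))

  when-xor : ∀ a b x → (b ≡ true → a ≡ false) → when (a xor b) x ≡ when a x ∙ when b x
  when-xor true  true  x b⇒¬a with () ← b⇒¬a refl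
  when-xor true  false x _    = sym (identityʳ x)
  when-xor false true  x _    = sym (identityˡ x)
  when-xor false false x _    = sym (identityˡ ε)

  sum-when-xor : {X : Set} (a b : X → Bool) (f : X → A) (xs : List X) →
                 (∀ x → b x ≡ true → a x ≡ false) →
                 sum (λ x → when (a x xor b x) (f x)) xs
                   ≡ sum (λ x → when (a x) (f x)) xs ∙ sum (λ x → when (b x) (f x)) xs
  sum-when-xor a b f xs disjoint =
    trans (sum-cong (λ x → when-xor (a x) (b x) (f x) (disjoint x)) xs) (sum-∙ _ _ xs)

  sum-neg : ∀ n (f : Vertex n → A) → sum f (allVertices n) ≡ sum (f ∘ neg) (allVertices n)
  sum-neg zero    f = refl
  sum-neg (suc n) f = begin
    sum f (List.map (true ∷_) V ++ List.map (false ∷_) V)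
      ≡⟨ halves f ⟩
    sum (λ u → f (true ∷ u)) V ∙ sum (λ u → f (false ∷ u)) V
      ≡⟨ comm _ _ ⟩
    sum (λ u → f (false ∷ u)) V ∙ sum (λ u → f (true ∷ u)) V
      ≡⟨ cong₂ _∙_ (sum-neg n _) (sum-neg n _) ⟩
    sum (λ u → f (false ∷ neg u)) V ∙ sum (λ u → f (true ∷ neg u)) V
      ≡⟨ halves (f ∘ neg) ⟨
    sum (f ∘ neg) (List.map (true ∷_) V ++ List.map (false ∷_) V) ∎
    where
    V = allVertices n
    halves : (g : Vertex (suc n) → A) →
             sum g (List.map (true ∷_) V ++ List.map (false ∷_) V)
               ≡ sum (λ u → g (true ∷ u)) V ∙ sum (λ u → g (false ∷ u)) V
    halves g = trans (sum-++ g (List.map (true ∷_) V) (List.map (false ∷_) V))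
                     (cong₂ _∙_ (sum-map g (true ∷_) V) (sum-map g (false ∷_) V))

  sum-δ : ∀ n (v : Vertex n) (f : Vertex n → A) →
          sum (λ u → when (does (u ≟ᵥ v)) (f u)) (allVertices n) ≡ f v
  sum-δ zero    []      f = identityʳ (f [])
  sum-δ (suc n) (b ∷ v) f =
    trans (sum-++ _ (List.map (true ∷_) V) _)
          (trans (cong₂ _∙_ (sum-map _ (true ∷_) V) (sum-map _ (false ∷_) V)) (halves b))
    where
    V = allVertices n
    halves : ∀ b → sum (λ u → when (does (true ∷ u ≟ᵥ b ∷ v)) (f (true ∷ u))) V
                     ∙ sum (λ u → when (does (false ∷ u ≟ᵥ b ∷ v)) (f (false ∷ u))) V
                   ≡ f (b ∷ v)
    halves true  = trans (cong₂ _∙_ (sum-δ n v _) (sum-ε V)) (identityʳ _)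
    halves false = trans (cong₂ _∙_ (sum-ε V) (sum-δ n v _)) (identityˡ _)

  sum-antipodalPair : ∀ {n} (v : Vertex (suc n)) (f : Vertex (suc n) → A) →
                      sum (λ u → when (antipodalPair v u) (f u)) (allVertices (suc n))
                        ≡ f v ∙ f (neg v)
  sum-antipodalPair {n} v f =
    trans (sum-when-xor (λ u → does (u ≟ᵥ v)) (λ u → does (u ≟ᵥ neg v)) f (allVertices (suc n))
                        exclusive)
          (cong₂ _∙_ (sum-δ (suc n) v f) (sum-δ (suc n) (neg v) f))
    where
    exclusive : ∀ u → does (u ≟ᵥ neg v) ≡ true → does (u ≟ᵥ v) ≡ false
    exclusive u _  with u ≟ᵥ neg v | u ≟ᵥ v
    exclusive u _  | yes refl | yes eq = ⊥-elim (neg-≢ v (sym eq))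
    exclusive u _  | _        | no _   = refl
    exclusive u () | no _     | yes _

  sum-allColorings-suc : ∀ n (g : Coloring (suc n) → A) → Extensional g →
    sum g (allColorings (suc n)) ≡ sum (λ ct → sum (λ cf → g (ct ∣ cf)) (allColorings n)) (allColorings n)
  sum-allColorings-suc n g g-ext =
    trans (sum-concatMap g _ C)
          (sum-cong (λ ct → trans (sum-map g _ C) (sum-cong (λ cf → g-ext λ { (_ ∷ _) → refl }) C)) C)
    where C = allColorings n

  -- c ↦ c ⊕ t is an involution, so it permutes the colorings.
  sum-⊕ : ∀ n (t : Coloring n) (g : Coloring n → A) → Extensional g →
          sum g (allColorings n) ≡ sum (λ c → g (c ⊕ t)) (allColorings n)
  sum-⊕ zero t g g-ext with t [] in t[]
  ... | false = cong₂ _∙_ (g-ext λ { [] → sym t[] })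
                          (cong (_∙ ε) (g-ext λ { [] → cong not (sym t[]) }))
  ... | true  =
    trans (cong (g (λ _ → false) ∙_) (identityʳ _))
          (trans (comm _ _)
                 (trans (cong₂ _∙_ (g-ext λ { [] → sym t[] }) (g-ext λ { [] → cong not (sym t[]) }))
                        (cong (g ((λ _ → false) ⊕ t) ∙_) (sym (identityʳ _)))))
  sum-⊕ (suc n) t g g-ext = begin
    sum g (allColorings (suc n))
      ≡⟨ sum-allColorings-suc n g g-ext ⟩
    sum (λ ct → sum (λ cf → g (ct ∣ cf)) C) C
      ≡⟨ sum-⊕ n t₁ _ (λ ct≗ → sum-cong (λ cf → g-ext (∣-cong ct≗ λ _ → refl)) C) ⟩
    sum (λ ct → sum (λ cf → g ((ct ⊕ t₁) ∣ cf)) C) C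
      ≡⟨ sum-cong (λ ct → sum-⊕ n t₀ _ (λ cf≗ → g-ext (∣-cong (λ _ → refl) cf≗))) C ⟩
    sum (λ ct → sum (λ cf → g ((ct ⊕ t₁) ∣ (cf ⊕ t₀))) C) C
      ≡⟨ sum-cong (λ ct → sum-cong (λ cf → g-ext λ { (true ∷ _) → refl ; (false ∷ _) → refl }) C) C ⟩
    sum (λ ct → sum (λ cf → g ((ct ∣ cf) ⊕ t)) C) C
      ≡⟨ sum-allColorings-suc n (λ c → g (c ⊕ t)) (λ c≗d → g-ext λ u → cong (_xor t u) (c≗d u)) ⟨
    sum (λ c → g (c ⊕ t)) (allColorings (suc n)) ∎
    where
    C = allColorings n
    t₁ t₀ : Coloring n
    t₁ v = t (true ∷ v)
    t₀ v = t (false ∷ v)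
    ∣-cong : ∀ {ct ct′ cf cf′ : Coloring n} → ct ≗ ct′ → cf ≗ cf′ → (ct ∣ cf) ≗ (ct′ ∣ cf′)
    ∣-cong ct≗ _   (true  ∷ v) = ct≗ v
    ∣-cong _   cf≗ (false ∷ v) = cf≗ v

open ListSum ℕP.+-0-isCommutativeMonoid
module ℤSum = ListSum ℤP.+-0-isCommutativeMonoid

does-true⇒ : {P : Set} (P? : Dec P) → does P? ≡ true → P
does-true⇒ (yes p) _ = p
does-true⇒ (no _) ()

count : {X : Set} → (X → Bool) → List X → ℕ
count p = sum (λ x → when (p x) 1)

length-filter : {X : Set} {P : X → Set} (P? : Decidable P) (xs : List X) →
                length (filter P? xs) ≡ count (does ∘ P?) xs
length-filter P? []       = refl
length-filter P? (x ∷ xs) with does (P? x)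
... | true  = cong suc (length-filter P? xs)
... | false = length-filter P? xs

countV≡count : ∀ {n} (p : Vertex n → Bool) → countV p ≡ count p (allVertices n)
countV≡count {n} p = trans (length-filter (λ v → p v Bool.≟ true) (allVertices n))
                           (sum-cong (λ v → cong (λ b → when b 1) (does-true v)) (allVertices n))
  where
  does-true : ∀ v → does (p v Bool.≟ true) ≡ p v
  does-true v with p v
  ... | true  = refl
  ... | false = refl

count-true : ∀ n → count (λ _ → true) (allVertices n) ≡ 2 ^ n
count-true zero    = refl
count-true (suc n) = begin
  count (λ _ → true) (List.map (true ∷_) V ++ List.map (false ∷_) V)
    ≡⟨ sum-++ (λ _ → 1) (List.map (true ∷_) V) _ ⟩
  count (λ _ → true) (List.map (true ∷_) V) + count (λ _ → true) (List.map (false ∷_) V)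
    ≡⟨ cong₂ _+_ (trans (sum-map (λ _ → 1) _ V) (count-true n))
                 (trans (sum-map (λ _ → 1) _ V) (count-true n)) ⟩
  2 ^ n + 2 ^ n
    ≡⟨ cong ((2 ^ n) +_) (ℕP.+-identityʳ (2 ^ n)) ⟨
  2 ^ suc n ∎
  where
  V = allVertices n
  open ≡-Reasoning

double-count : {X Y : Set} (p : X → Bool) (q : X → Y → Bool) (w : ℕ) (xs : List X) (ys : List Y) →
               (∀ x → p x ≡ true → count (q x) ys ≡ w) →
               w * count p xs ≡ sum (λ y → count (λ x → p x ∧ q x y) xs) ys
double-count p q w xs ys weight = begin
  w * count p xs                                  ≡⟨ *-sum xs ⟩
  sum (λ x → w * when (p x) 1) xs                 ≡⟨ sum-cong pointwise xs ⟩
  sum (λ x → count (λ y → p x ∧ q x y) ys) xs     ≡⟨ sum-swap _ xs ys ⟩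
  sum (λ y → count (λ x → p x ∧ q x y) xs) ys     ∎
  where
  open ≡-Reasoning
  *-sum : ∀ xs → w * count p xs ≡ sum (λ x → w * when (p x) 1) xs
  *-sum []       = ℕP.*-zeroʳ w
  *-sum (x ∷ xs) = trans (ℕP.*-distribˡ-+ w _ (count p xs)) (cong (w * when (p x) 1 +_) (*-sum xs))
  pointwise : ∀ x → w * when (p x) 1 ≡ count (λ y → p x ∧ q x y) ys
  pointwise x with p x in px
  ... | true  = trans (ℕP.*-identityʳ w) (sym (weight x px))
  ... | false = trans (ℕP.*-zeroʳ w) (sym (sum-ε ys))

module _ {n : ℕ} where

  InB-cong : ∀ {m a} {c d : Coloring n} → c ≗ d → InB m a c → InB m a d
  InB-cong {c = c} {d} c≗d (balanced , black , antipodal) =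
    All.map (λ {j} → trans (sym (blackSumCoord-cong j))) balanced ,
    trans (sym (countV-cong c≗d)) black ,
    trans (sym (countV-cong λ u → cong₂ _∧_ (c≗d u) (c≗d (neg u)))) antipodal
    where
    blackSumCoord-cong : ∀ j → blackSumCoord c j ≡ blackSumCoord d j
    blackSumCoord-cong j =
      ℤSum.sum-cong (λ u → cong (λ b → ℤSum.when b (sign (lookup u j))) (c≗d u)) (allVertices n)
    countV-cong : {p q : Vertex n → Bool} → p ≗ q → countV p ≡ countV q
    countV-cong {p} {q} p≗q =
      trans (countV≡count p)
            (trans (sum-cong (λ u → cong (λ b → when b 1) (p≗q u)) (allVertices n)) (sym (countV≡count q)))

  inB?-cong : ∀ m a → Extensional (λ c → does (inB? m a c))
  inB?-cong m a {c} {d} c≗d =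
    does-⇔ (mk⇔ (InB-cong {m} {a} c≗d) (InB-cong {m} {a} (sym ∘ c≗d))) (inB? m a c) (inB? m a d)

  -- Inclusion–exclusion over the vertices, with the antipodal reindexing count (c ∘ neg) = count c.
  count-whitePairs : (c : Coloring n) →
    count (λ u → not (c u) ∧ not (c (neg u))) (allVertices n) + 2 * blackCount c
      ≡ 2 ^ n + antipodalBlackVertices c
  count-whitePairs c = begin
    count W V + 2 * blackCount c
      ≡⟨ cong (λ b → count W V + 2 * b) (countV≡count c) ⟩
    count W V + 2 * count c V
      ≡⟨ cong (λ x → count W V + (count c V + x)) (trans (ℕP.+-identityʳ _) (sum-neg n _)) ⟩
    count W V + (count c V + count (c ∘ neg) V)
      ≡⟨ trans (sum-∙ _ _ V) (cong (count W V +_) (sum-∙ _ _ V)) ⟨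
    sum (λ u → when (W u) 1 + (when (c u) 1 + when (c (neg u)) 1)) V
      ≡⟨ sum-cong (λ u → inclusion-exclusion (c u) (c (neg u))) V ⟩
    sum (λ u → 1 + when (c u ∧ c (neg u)) 1) V
      ≡⟨ sum-∙ _ _ V ⟩
    count (λ _ → true) V + count (λ u → c u ∧ c (neg u)) V
      ≡⟨ cong₂ _+_ (sym (count-true n)) (countV≡count (λ u → c u ∧ c (neg u))) ⟨
    2 ^ n + antipodalBlackVertices c ∎
    where
    open ≡-Reasoning
    V = allVertices n
    W : Vertex n → Bool
    W u = not (c u) ∧ not (c (neg u))
    inclusion-exclusion : ∀ a b →
      when (not a ∧ not b) 1 + (when a 1 + when b 1) ≡ 1 + when (a ∧ b) 1
    inclusion-exclusion true  true  = refl
    inclusion-exclusion true  false = refl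
    inclusion-exclusion false true  = refl
    inclusion-exclusion false false = refl

  Disjoint : Coloring n → Coloring n → Set
  Disjoint c t = ∀ u → t u ≡ true → c u ≡ false

  blackCount-⊕ : ∀ c t → Disjoint c t → blackCount (c ⊕ t) ≡ blackCount c + blackCount t
  blackCount-⊕ c t disjoint = begin
    blackCount (c ⊕ t)             ≡⟨ countV≡count (c ⊕ t) ⟩
    count (c ⊕ t) V                ≡⟨ sum-when-xor c t (λ _ → 1) V disjoint ⟩
    count c V + count t V          ≡⟨ cong₂ _+_ (countV≡count c) (countV≡count t) ⟨
    blackCount c + blackCount t    ∎
    where
    open ≡-Reasoning
    V = allVertices n

  blackSumCoord-⊕ : ∀ c t → Disjoint c t →
                    ∀ j → blackSumCoord (c ⊕ t) j ≡ blackSumCoord c j ℤ.+ blackSumCoord t j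
  blackSumCoord-⊕ c t disjoint j = ℤSum.sum-when-xor c t (λ u → sign (lookup u j)) (allVertices n) disjoint

  antipodalBlackVertices-⊕ : ∀ c t → Disjoint c t → t ∘ neg ≗ t →
    antipodalBlackVertices (c ⊕ t) ≡ antipodalBlackVertices c + blackCount t
  antipodalBlackVertices-⊕ c t disjoint t-symmetric = begin
    antipodalBlackVertices (c ⊕ t)
      ≡⟨ countV≡count (λ u → (c ⊕ t) u ∧ (c ⊕ t) (neg u)) ⟩
    count (λ u → (c u xor t u) ∧ (c (neg u) xor t (neg u))) V
      ≡⟨ sum-cong (λ u → cong (λ b → when b 1) (both-toggled u)) V ⟩
    count (λ u → (c u ∧ c (neg u)) xor t u) V
      ≡⟨ sum-when-xor _ t (λ _ → 1) V (λ u tu → cong (_∧ c (neg u)) (disjoint u tu)) ⟩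
    count (λ u → c u ∧ c (neg u)) V + count t V
      ≡⟨ cong₂ _+_ (countV≡count (λ u → c u ∧ c (neg u))) (countV≡count t) ⟨
    antipodalBlackVertices c + blackCount t ∎
    where
    open ≡-Reasoning
    V = allVertices n
    xor-∧-xor : ∀ a a′ b → (b ≡ true → a ≡ false) → (b ≡ true → a′ ≡ false) →
                (a xor b) ∧ (a′ xor b) ≡ (a ∧ a′) xor b
    xor-∧-xor a     a′    false _ _ =
      trans (cong₂ _∧_ (BoolP.xor-identityʳ a) (BoolP.xor-identityʳ a′))
            (sym (BoolP.xor-identityʳ (a ∧ a′)))
    xor-∧-xor false false true  _ _ = refl
    xor-∧-xor true  _     true  b⇒¬a _ with () ← b⇒¬a refl
    xor-∧-xor false true  true  _ b⇒¬a′ with () ← b⇒¬a′ refl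
    both-toggled : ∀ u → (c u xor t u) ∧ (c (neg u) xor t (neg u)) ≡ (c u ∧ c (neg u)) xor t u
    both-toggled u =
      trans (cong (λ b → (c u xor t u) ∧ (c (neg u) xor b)) (t-symmetric u))
            (xor-∧-xor (c u) (c (neg u)) (t u) (disjoint u) (disjoint (neg u) ∘ trans (t-symmetric u)))

module _ {n : ℕ} (v : Vertex (suc n)) where

  blackCount-antipodalPair : blackCount (antipodalPair v) ≡ 2
  blackCount-antipodalPair = trans (countV≡count (antipodalPair v)) (sum-antipodalPair v (λ _ → 1))

  blackSumCoord-antipodalPair : ∀ j → blackSumCoord (antipodalPair v) j ≡ ℤ.+ 0
  blackSumCoord-antipodalPair j =
    trans (ℤSum.sum-antipodalPair v _)
          (trans (cong (ℤ._+_ (sign (lookup v j))) (cong sign (VecP.lookup-map j not v)))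
                 (sign-cancel (lookup v j)))
    where
    sign-cancel : ∀ b → sign b ℤ.+ sign (not b) ≡ ℤ.+ 0
    sign-cancel true  = refl
    sign-cancel false = refl

  InB-⊕-antipodalPair : ∀ {m a} (c : Coloring (suc n)) → c v ≡ false → c (neg v) ≡ false →
                        InB m a c ⇔ InB (m + 2) (a + 1) (c ⊕ antipodalPair v)
  InB-⊕-antipodalPair {m} {a} c cv c-v = mk⇔ to from
    where
    t = antipodalPair v

    disjoint : Disjoint c t
    disjoint u tu with antipodalPair-true v u tu
    ... | inj₁ refl = cv
    ... | inj₂ refl = c-v

    black : blackCount (c ⊕ t) ≡ blackCount c + 2
    black = trans (blackCount-⊕ c t disjoint) (cong (blackCount c +_) blackCount-antipodalPair)

    antipodal : antipodalBlackVertices (c ⊕ t) ≡ antipodalBlackVertices c + 2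
    antipodal = trans (antipodalBlackVertices-⊕ c t disjoint (antipodalPair-neg v))
                      (cong (antipodalBlackVertices c +_) blackCount-antipodalPair)

    sum-unchanged : ∀ j → blackSumCoord (c ⊕ t) j ≡ blackSumCoord c j
    sum-unchanged j = trans (blackSumCoord-⊕ c t disjoint j)
                            (trans (cong (ℤ._+_ (blackSumCoord c j)) (blackSumCoord-antipodalPair j))
                                   (ℤP.+-identityʳ _))

    2[a+1] : 2 * (a + 1) ≡ 2 * a + 2
    2[a+1] = ℕP.*-distribˡ-+ 2 a 1

    to : InB m a c → InB (m + 2) (a + 1) (c ⊕ t)
    to (balanced , bc , ac) =
      All.map (λ {j} eq → trans (sum-unchanged j) eq) balanced ,
      trans black (cong (_+ 2) bc) ,
      trans antipodal (trans (cong (_+ 2) ac) (sym 2[a+1]))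

    from : InB (m + 2) (a + 1) (c ⊕ t) → InB m a c
    from (balanced , bc , ac) =
      All.map (λ {j} eq → trans (sym (sum-unchanged j)) eq) balanced ,
      ℕP.+-cancelʳ-≡ 2 _ _ (trans (sym black) bc) ,
      ℕP.+-cancelʳ-≡ 2 _ _ (trans (sym antipodal) (trans ac 2[a+1]))

halve-weight : ∀ {W K P i} → K ≤ P → W + 2 * K ≡ 2 * P + 2 * i → W ≡ 2 * ((P ∸ K) + i)
halve-weight {W} {K} {P} {i} K≤P eq = sym (ℕP.+-cancelʳ-≡ (2 * K) _ _ (begin
  2 * ((P ∸ K) + i) + 2 * K    ≡⟨ rearrange (P ∸ K) i K ⟩
  2 * ((P ∸ K) + K) + 2 * i    ≡⟨ cong (λ x → 2 * x + 2 * i) (ℕP.m∸n+n≡m K≤P) ⟩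
  2 * P + 2 * i                ≡⟨ eq ⟨
  W + 2 * K                    ∎))
  where
  open ≡-Reasoning
  open +-*-Solver
  rearrange : ∀ d i K → 2 * (d + i) + 2 * K ≡ 2 * (d + K) + 2 * i
  rearrange = solve 3 (λ d i K → con 2 :* (d :+ i) :+ con 2 :* K := con 2 :* (d :+ K) :+ con 2 :* i) refl

module Recurrence (m k i : ℕ) (2k≤2^m : 2 * k ≤ 2 ^ m) where

  V = allVertices (suc m)
  C = allColorings (suc m)

  inB₁ inB₂ : Coloring (suc m) → Bool
  inB₁ c = does (inB? (2 * k) i c)
  inB₂ c = does (inB? (2 * k + 2) (i + 1) c)

  whitePair blackPair : Coloring (suc m) → Vertex (suc m) → Bool
  whitePair c u = not (c u) ∧ not (c (neg u))
  blackPair c u = c u ∧ c (neg u)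

  whitePairs-inB₁ : ∀ c → inB₁ c ≡ true →
                    count (whitePair c) V ≡ 2 * ((2 ^ m ∸ 2 * k) + i)
  whitePairs-inB₁ c c∈B with _ , black , antipodal ← does-true⇒ (inB? (2 * k) i c) c∈B =
    halve-weight 2k≤2^m (begin
    count (whitePair c) V + 2 * (2 * k)         ≡⟨ cong (λ b → count (whitePair c) V + 2 * b) black ⟨
    count (whitePair c) V + 2 * blackCount c    ≡⟨ count-whitePairs c ⟩
    2 ^ suc m + antipodalBlackVertices c        ≡⟨ cong ((2 ^ suc m) +_) antipodal ⟩
    2 * 2 ^ m + 2 * i                           ∎)
    where open ≡-Reasoning

  blackPairs-inB₂ : ∀ c → inB₂ c ≡ true → count (blackPair c) V ≡ 2 * (i + 1)
  blackPairs-inB₂ c c∈B with _ , _ , antipodal ← does-true⇒ (inB? (2 * k + 2) (i + 1) c) c∈B =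
    trans (sym (countV≡count (λ u → c u ∧ c (neg u)))) antipodal

  blackPair-⊕-antipodalPair : ∀ c u → blackPair (c ⊕ antipodalPair u) u ≡ whitePair c u
  blackPair-⊕-antipodalPair c u rewrite antipodalPair-self u | antipodalPair-neg-self u =
    cong₂ _∧_ (BoolP.xor-comm (c u) true) (BoolP.xor-comm (c (neg u)) true)

  toggled : ∀ c u → inB₂ (c ⊕ antipodalPair u) ∧ blackPair (c ⊕ antipodalPair u) u
                      ≡ inB₁ c ∧ whitePair c u
  toggled c u =
    trans (cong (inB₂ (c ⊕ antipodalPair u) ∧_) (blackPair-⊕-antipodalPair c u))
          (∧-cong-when-true (whitePair c u) λ white → let cu , c-u = both-false (c u) _ white in
            sym (does-⇔ (InB-⊕-antipodalPair u {2 * k} {i} c cu c-u)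
                        (inB? (2 * k) i c) (inB? (2 * k + 2) (i + 1) (c ⊕ antipodalPair u))))
    where
    ∧-cong-when-true : ∀ {x y} b → (b ≡ true → x ≡ y) → x ∧ b ≡ y ∧ b
    ∧-cong-when-true false _   = trans (BoolP.∧-zeroʳ _) (sym (BoolP.∧-zeroʳ _))
    ∧-cong-when-true true  x≡y = cong (_∧ true) (x≡y refl)
    both-false : ∀ a b → not a ∧ not b ≡ true → a ≡ false × b ≡ false
    both-false false false _ = refl , refl

  pairs-per-vertex : ∀ u → count (λ c → inB₂ c ∧ blackPair c u) C
                           ≡ count (λ c → inB₁ c ∧ whitePair c u) C
  pairs-per-vertex u =
    trans (sum-⊕ (suc m) (antipodalPair u) (λ c → when (inB₂ c ∧ blackPair c u) 1)
                 (λ c≗d → cong (λ b → when b 1)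
                               (cong₂ _∧_ (inB?-cong (2 * k + 2) (i + 1) c≗d)
                                          (cong₂ _∧_ (c≗d u) (c≗d (neg u))))))
          (sum-cong (λ c → cong (λ b → when b 1) (toggled c u)) C)

  recurrence : ((2 ^ m ∸ 2 * k) + i) * cardB (suc m) (2 * k) i
                 ≡ (i + 1) * cardB (suc m) (2 * k + 2) (i + 1)
  recurrence = ℕP.*-cancelˡ-≡ _ _ 2 (begin
    2 * (X * cardB (suc m) (2 * k) i)
      ≡⟨ ℕP.*-assoc 2 X _ ⟨
    2 * X * cardB (suc m) (2 * k) i
      ≡⟨ cong (2 * X *_) (length-filter (inB? (2 * k) i) C) ⟩
    2 * X * count inB₁ C
      ≡⟨ double-count inB₁ whitePair (2 * X) C V whitePairs-inB₁ ⟩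
    sum (λ u → count (λ c → inB₁ c ∧ whitePair c u) C) V
      ≡⟨ sum-cong pairs-per-vertex V ⟨
    sum (λ u → count (λ c → inB₂ c ∧ blackPair c u) C) V
      ≡⟨ double-count inB₂ blackPair (2 * (i + 1)) C V blackPairs-inB₂ ⟨
    2 * (i + 1) * count inB₂ C
      ≡⟨ cong (2 * (i + 1) *_) (length-filter (inB? (2 * k + 2) (i + 1)) C) ⟨
    2 * (i + 1) * cardB (suc m) (2 * k + 2) (i + 1)
      ≡⟨ ℕP.*-assoc 2 (i + 1) _ ⟩
    2 * ((i + 1) * cardB (suc m) (2 * k + 2) (i + 1)) ∎)
    where
    open ≡-Reasoning
    X = (2 ^ m ∸ 2 * k) + i

theorem2p1 : (n k i : ℕ) → 1 ≤ n → 1 ≤ k → k + 1 ≤ 2 ^ (n ∸ 2) → i ≤ k →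
    ((2 ^ (n ∸ 1) ∸ 2 * k) + i) * cardB n (2 * k) i ≡ (i + 1) * cardB n (2 * k + 2) (i + 1)
theorem2p1 zero k i () _ _ _
theorem2p1 (suc zero) k i _ 1≤k k+1≤1 _ with s≤s () ← ℕP.≤-trans (ℕP.+-monoˡ-≤ 1 1≤k) k+1≤1
theorem2p1 (suc (suc m)) k i _ _ k+1≤2^m _ =
  Recurrence.recurrence (suc m) k i (ℕP.*-monoʳ-≤ 2 (ℕP.≤-trans (ℕP.m≤m+n k 1) k+1≤2^m))
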